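{- Let $G$ be a loop directed graph with vertex set $V$, and let $B_G=(V,V',E)$ be its associated bipartite graph. Let $\mathcal{M}=\{\{i_1,j_1\},\dots,\{i_t,j_t\}\}$ be a constrained matching in $B_G$ with $i_k\in V$, $j_k\in V'$, indexed so that $\{i_k,j_l\}\notin E$ for all $1\le l<k\le t$. Then $V\setminus\{i_1,\dots,i_t\}$ is a zero forcing set of $G$ with chronological list of forces $j_1\to i_1,\ j_2\to i_2,\ \dots,\ j_t\to i_t$ (where $j_k$ and $i_k$ are identified with the corresponding vertices of $G$).
   Context: A loop directed graph is a finite directed graph in which loops are allowed. The bipartite graph $B_G=(V,V',E)$ associated with $G$ has two copies $V=\{i_1,\dots,i_n\}$ and $V'=\{j_1,\dots,j_n\}$ of the vertex set of $G$, and $\{i_s,j_t\}\in E$ iff there is a directed edge from vertex $j_t$ to vertex $i_s$ in $G$. A $t$-matching is a set of $t$ pairwise disjoint edges; it is constrained if no other $t$-matching has the same set of matched vertices. Color change rule in a loop directed graph: each vertex is black or white; if exactly one out-neighbor $j$ of vertex $i$ is white (possibly $j=i$; $i$ need not be black), then $j$ is turned black, and we say $i$ forces $j$, written $i\to j$. A zero forcing set is a set $S$ such that starting with exactly $S$ black and applying the rule repeatedly, all vertices become black; a chronological list of forces for $S$ is a list of the forces in the order they are performed to turn all vertices black. -}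

module Defs where

open import Data.Nat using (ℕ; _<_)
open import Data.Fin using (Fin; toℕ)
open import Data.Product using (Σ; ∃; _×_; _,_; proj₁; proj₂)
open import Data.Sum using (_⊎_)
open import Data.List using (List; []; _∷_)
open import Relation.Nullary using (¬_)
open import Relation.Binary.PropositionalEquality using (_≡_; _≢_)
open import Function.Bundles using (_⇔_)

-- A loop directed graph on the vertex set Fin n: an arbitrary binary
-- relation (loops allowed).  Adj u v means there is a directed edge u → v.
record LoopDigraph : Set₁ where
  field
    n   : ℕ
    Adj : Fin n → Fin n → Set

open LoopDigraph public

Vtx : LoopDigraph → Set
Vtx G = Fin (n G)

-- Bipartite graph B_G = (V, V', E): vertices of V and V' are both copies of
-- Vtx G; {i, j'} ∈ E (i ∈ V, j' ∈ V') iff there is an edge j → i in G.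
BEdge : (G : LoopDigraph) → Vtx G → Vtx G → Set
BEdge G i j = Adj G j i

record IsMatching (G : LoopDigraph) (t : ℕ) (M : Fin t → Vtx G × Vtx G) : Set where
  field
    edge      : ∀ k → BEdge G (proj₁ (M k)) (proj₂ (M k))
    disjointV : ∀ k l → k ≢ l → proj₁ (M k) ≢ proj₁ (M l)
    disjointV' : ∀ k l → k ≢ l → proj₂ (M k) ≢ proj₂ (M l)

_∈V[_] : ∀ {A : Set} {t} → A → (Fin t → A × A) → Set
v ∈V[ M ] = ∃ λ k → proj₁ (M k) ≡ v

_∈V'[_] : ∀ {A : Set} {t} → A → (Fin t → A × A) → Set
v ∈V'[ M ] = ∃ λ k → proj₂ (M k) ≡ v

_∈E[_] : ∀ {A : Set} {t} → A × A → (Fin t → A × A) → Set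
e ∈E[ M ] = ∃ λ k → M k ≡ e

-- Constrained t-matching: no other t-matching has the same set of matched
-- vertices (i.e. any t-matching with the same matched vertices has the same
-- edge set).
record IsConstrainedMatching (G : LoopDigraph) (t : ℕ) (M : Fin t → Vtx G × Vtx G) : Set₁ where
  field
    matching    : IsMatching G t M
    constrained : ∀ (M' : Fin t → Vtx G × Vtx G) → IsMatching G t M' →
                  (∀ v → (v ∈V[ M ]) ⇔ (v ∈V[ M' ])) →
                  (∀ v → (v ∈V'[ M ]) ⇔ (v ∈V'[ M' ])) →
                  ∀ e → (e ∈E[ M ]) ⇔ (e ∈E[ M' ])

-- Colourings: a predicate "is black" on vertices.
Colouring : LoopDigraph → Set₁
Colouring G = Vtx G → Set

-- Color change rule: u forces v at colouring B iff v is an out-neighbour of u,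
-- v is white, and every other out-neighbour of u is black (u itself may be white).
Forces : (G : LoopDigraph) → Colouring G → Vtx G → Vtx G → Set
Forces G B u v = Adj G u v × ¬ B v × (∀ w → Adj G u w → w ≢ v → B w)

addBlack : (G : LoopDigraph) → Colouring G → Vtx G → Colouring G
addBlack G B v w = B w ⊎ w ≡ v

ChronList : (G : LoopDigraph) → Colouring G → List (Vtx G × Vtx G) → Set
ChronList G B [] = ∀ v → B v
ChronList G B ((u , v) ∷ L) = Forces G B u v × ChronList G (addBlack G B v) L

ZeroForcingSet : (G : LoopDigraph) → Colouring G → Set
ZeroForcingSet G S = ∃ λ L → ChronList G S L

complementV : (G : LoopDigraph) {t : ℕ} → (Fin t → Vtx G × Vtx G) → Colouring G
complementV G M v = ¬ (v ∈V[ M ])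

forceList : (G : LoopDigraph) {t : ℕ} → (Fin t → Vtx G × Vtx G) → List (Vtx G × Vtx G)
forceList G {t} M = Data.List.tabulate {n = t} (λ k → proj₂ (M k) , proj₁ (M k))

-- Forcing i_1, …, i_t in order keeps the white set equal to {i_k, …, i_t} just before
-- step k.  The edge {i_k, j_k} makes i_k an out-neighbour of j_k, and the ordering
-- hypothesis rules out i_l with l > k, so i_k is the only white out-neighbour of j_k.
module Submission where

open import Defs
open import Data.Nat using (ℕ; zero; suc; s≤s; _<_)
open import Data.Fin using (Fin; toℕ; _≟_) renaming (zero to fzero; suc to fsuc)
open import Data.Fin.Properties using (any?; <-cmp; suc-injective)
open import Data.Product using (_×_; proj₁; proj₂; _,_; ∃)
open import Data.Sum using (_⊎_; inj₁; inj₂)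
open import Data.Empty using (⊥-elim)
open import Data.List using (tabulate)
open import Relation.Nullary using (¬_; yes; no)
open import Relation.Binary using (tri<; tri≈; tri>)
open import Relation.Binary.PropositionalEquality using (_≡_; _≢_; refl; sym; subst)

record ForcingSequence (G : LoopDigraph) (B : Colouring G) (m : ℕ) (I J : Fin m → Vtx G) : Set where
  field
    targets-distinct : ∀ a b → a ≢ b → I a ≢ I b
    forcing-edge     : ∀ a → Adj G (J a) (I a)
    targets-white    : ∀ a → ¬ B (I a)
    neighbours-early : ∀ a w → Adj G (J a) w → w ≢ I a → B w ⊎ ∃ λ b → toℕ b < toℕ a × w ≡ I b
    black-or-target  : ∀ v → B v ⊎ ∃ λ a → v ≡ I a

module _ {G : LoopDigraph} {B : Colouring G} {m : ℕ} {I J : Fin (suc m) → Vtx G}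
         (S : ForcingSequence G B (suc m) I J) where
  open ForcingSequence S

  forcingSequence-head : Forces G B (J fzero) (I fzero)
  forcingSequence-head = forcing-edge fzero , targets-white fzero , others-black
    where
    others-black : ∀ w → Adj G (J fzero) w → w ≢ I fzero → B w
    others-black w w∈N ne with neighbours-early fzero w w∈N ne
    ... | inj₁ black = black
    ... | inj₂ (_ , () , _)

  forcingSequence-tail :
    ForcingSequence G (addBlack G B (I fzero)) m (λ a → I (fsuc a)) (λ a → J (fsuc a))
  forcingSequence-tail = record
    { targets-distinct = λ a b ne → targets-distinct (fsuc a) (fsuc b) (λ e → ne (suc-injective e))
    ; forcing-edge     = λ a → forcing-edge (fsuc a)
    ; targets-white    = targets-white′
    ; neighbours-early = neighbours-early′
    ; black-or-target  = black-or-target′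
    }
    where
    targets-white′ : ∀ a → ¬ addBlack G B (I fzero) (I (fsuc a))
    targets-white′ a (inj₁ black) = targets-white (fsuc a) black
    targets-white′ a (inj₂ e)     = targets-distinct (fsuc a) fzero (λ ()) e

    neighbours-early′ : ∀ a w → Adj G (J (fsuc a)) w → w ≢ I (fsuc a) →
                        addBlack G B (I fzero) w ⊎ ∃ λ b → toℕ b < toℕ a × w ≡ I (fsuc b)
    neighbours-early′ a w w∈N ne with neighbours-early (fsuc a) w w∈N ne
    ... | inj₁ black                  = inj₁ (inj₁ black)
    ... | inj₂ (fzero , _ , e)        = inj₁ (inj₂ e)
    ... | inj₂ (fsuc b , s≤s b<a , e) = inj₂ (b , b<a , e)

    black-or-target′ : ∀ v → addBlack G B (I fzero) v ⊎ ∃ λ a → v ≡ I (fsuc a)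
    black-or-target′ v with black-or-target v
    ... | inj₁ black        = inj₁ (inj₁ black)
    ... | inj₂ (fzero , e)  = inj₁ (inj₂ e)
    ... | inj₂ (fsuc a , e) = inj₂ (a , e)

forcingSequence⇒chronList : ∀ {G B} m {I J} → ForcingSequence G B m I J →
                            ChronList G B (tabulate (λ a → J a , I a))
forcingSequence⇒chronList zero S v with ForcingSequence.black-or-target S v
... | inj₁ black  = black
... | inj₂ (() , _)
forcingSequence⇒chronList (suc m) S =
  forcingSequence-head S , forcingSequence⇒chronList m (forcingSequence-tail S)

module _ (G : LoopDigraph) {t : ℕ} (M : Fin t → Vtx G × Vtx G) where
  private
    I J : Fin t → Vtx G
    I a = proj₁ (M a)
    J a = proj₂ (M a)

  unmatched-or-matched : ∀ v → complementV G M v ⊎ ∃ λ a → v ≡ I a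
  unmatched-or-matched v with any? (λ a → I a ≟ v)
  ... | yes (a , e) = inj₂ (a , sym e)
  ... | no  ne      = inj₁ ne

  matching⇒forcingSequence :
    IsMatching G t M →
    (∀ (l k : Fin t) → toℕ l < toℕ k → ¬ BEdge G (proj₁ (M k)) (proj₂ (M l))) →
    ForcingSequence G (complementV G M) t I J
  matching⇒forcingSequence matching no-back-edges = record
    { targets-distinct = disjointV
    ; forcing-edge     = edge
    ; targets-white    = λ a unmatched → unmatched (a , refl)
    ; neighbours-early = neighbours-early
    ; black-or-target  = unmatched-or-matched
    }
    where
    open IsMatching matching
    neighbours-early : ∀ a w → Adj G (J a) w → w ≢ I a →
                       complementV G M w ⊎ ∃ λ b → toℕ b < toℕ a × w ≡ I b
    neighbours-early a w w∈N ne with unmatched-or-matched w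
    ... | inj₁ unmatched = inj₁ unmatched
    ... | inj₂ (b , e) with <-cmp b a
    ...   | tri< b<a _ _ = inj₂ (b , b<a , e)
    ...   | tri≈ _ refl _ = ⊥-elim (ne e)
    ...   | tri> _ _ a<b = ⊥-elim (no-back-edges a b a<b (subst (Adj G (J a)) e w∈N))

lemma5p3 : (G : LoopDigraph) (t : ℕ) (M : Fin t → Vtx G × Vtx G) →
           IsConstrainedMatching G t M →
           (∀ (l k : Fin t) → toℕ l < toℕ k → ¬ BEdge G (proj₁ (M k)) (proj₂ (M l))) →
           ZeroForcingSet G (complementV G M) × ChronList G (complementV G M) (forceList G M)
lemma5p3 G t M constrainedMatching no-back-edges = (forceList G M , chronList) , chronList
  where
  chronList : ChronList G (complementV G M) (forceList G M)
  chronList = forcingSequence⇒chronList t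
    (matching⇒forcingSequence G M (IsConstrainedMatching.matching constrainedMatching) no-back-edges)
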